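{- For every integer $n \geq 8$ with $n \neq 11$, Right wins the Forbidden Leaf Variant of the Mixed Deletion Game played on the path $P_n$ regardless of which player moves first.
   Context: The Classic Variant of the Mixed Deletion Game is a two-player combinatorial game between Left and Right played on a finite simple undirected graph; players alternate turns. On her turn Left deletes one vertex together with all edges incident to it; on his turn Right deletes one edge. The game ends when a deletion creates an isolated vertex (a vertex of degree $0$), and the player whose deletion created an isolated vertex loses; thus a legal move is a deletion which does not create an isolated vertex, and a player with no legal move loses. The Forbidden Leaf Variant has the same rules with the additional restriction that Left may not delete a leaf (a vertex of degree $1$). $P_n$ denotes the path graph on $n$ vertices. -}

module Defs where

open import Data.Nat using (ℕ; zero; suc; _+_)
import Data.Nat
open import Data.Bool using (Bool; true; false; _∧_; _∨_; not; if_then_else_)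
open import Data.Fin using (Fin; toℕ; _≟_)
open import Data.List using (List; allFin; map)
open import Data.Nat.ListAction using (sum)
open import Data.Product using (_×_; ∃-syntax; Σ-syntax)
open import Relation.Binary.PropositionalEquality using (_≡_; _≢_)
open import Relation.Nullary using (¬_)
open import Relation.Nullary.Decidable using (⌊_⌋)

-- Finite simple graphs on (a subset of) the vertex labels Fin n.
-- `present v` says whether v is still a vertex; `adj u w` is the
-- adjacency relation (symmetric, irreflexive, only between present
-- vertices -- these invariants hold for the initial graph P_n and are
-- preserved by the moves below).

record Graph (n : ℕ) : Set where
  constructor graph
  field
    present : Fin n → Bool
    adj     : Fin n → Fin n → Bool
open Graph public

degree : ∀ {n} → Graph n → Fin n → ℕ
degree {n} G v = sum (map (λ w → if adj G v w then 1 else 0) (allFin n))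

Isolated : ∀ {n} → Graph n → Fin n → Set
Isolated G v = (present G v ≡ true) × (degree G v ≡ 0)

HasIsolated : ∀ {n} → Graph n → Set
HasIsolated G = ∃[ v ] Isolated G v

deleteVertex : ∀ {n} → Graph n → Fin n → Graph n
deleteVertex G v = graph
  (λ u → present G u ∧ not ⌊ u ≟ v ⌋)
  (λ u w → adj G u w ∧ not ⌊ u ≟ v ⌋ ∧ not ⌊ w ≟ v ⌋)

deleteEdge : ∀ {n} → Graph n → Fin n → Fin n → Graph n
deleteEdge G a b = graph
  (present G)
  (λ u w → adj G u w ∧
     not ((⌊ u ≟ a ⌋ ∧ ⌊ w ≟ b ⌋) ∨ (⌊ u ≟ b ⌋ ∧ ⌊ w ≟ a ⌋)))

data LeftMove {n} (G : Graph n) : Graph n → Set where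
  delV : (v : Fin n) → present G v ≡ true → degree G v ≢ 1 →
         ¬ HasIsolated (deleteVertex G v) →
         LeftMove G (deleteVertex G v)

data RightMove {n} (G : Graph n) : Graph n → Set where
  delE : (a b : Fin n) → adj G a b ≡ true →
         ¬ HasIsolated (deleteEdge G a b) →
         RightMove G (deleteEdge G a b)

-- Right has a winning strategy from G with Left to move / Right to move.
-- (A player with no legal move loses.)  Inductive, hence every play
-- following the strategy is finite.
data RightWinsLeftToMove {n} (G : Graph n) : Set
data RightWinsRightToMove {n} (G : Graph n) : Set

data RightWinsLeftToMove {n} G where
  allLeft : (∀ G' → LeftMove G G' → RightWinsRightToMove G') →
            RightWinsLeftToMove G

data RightWinsRightToMove {n} G where
  someRight : (G' : Graph n) → RightMove G G' → RightWinsLeftToMove G' →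
              RightWinsRightToMove G

path : (n : ℕ) → Graph n
path n = graph
  (λ _ → true)
  (λ i j → ⌊ Data.Nat._≟_ (suc (toℕ i)) (toℕ j) ⌋ ∨ ⌊ Data.Nat._≟_ (suc (toℕ j)) (toℕ i) ⌋)

-- Every position reachable from P_n is a disjoint union of paths, and only the multiset of
-- their numbers of vertices matters.  A legal Left move deletes a vertex at distance at least
-- 2 from both ends of its path (the ends are leaves, and deleting a neighbour of an end
-- isolates it), so it splits a path of a + b + 1 vertices into paths of a, b ≥ 2 vertices;
-- a legal Right move splits a path of c + d vertices into paths of c, d ≥ 2 vertices.
--
-- Call a multiset safe if its paths with 4, 5, 6, 7, 8 or 11 vertices can be grouped into
-- the blocks {4}, {8}, {4,5}, {4,6}, {4,7}, {4,11}, {8,11}, {4,5,7}.  After any Left move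
-- from a safe position, Right has a cut that makes the position safe again; this is a finite
-- case analysis on the lengths involved.  Every Left move removes a vertex, so Left
-- eventually runs out of moves.  For n ≥ 8, n ≠ 11 the path P_n is safe, and so is the
-- position 4 + (n - 4) that Right creates when he moves first.

{-# OPTIONS --safe #-}
module Submission where

open import Defs
open import Data.Bool using (true; false; T; not; _∧_; _∨_; if_then_else_)
open import Data.Bool.Properties using (T-∧; T-∨; T-≡)
open import Data.Empty using (⊥; ⊥-elim)
open import Data.Fin using (Fin; toℕ; fromℕ<) renaming (zero to fzero; suc to fsuc)
import Data.Fin as Fin
open import Data.Fin.Properties using (toℕ-injective; toℕ-fromℕ<; toℕ<n) renaming (suc-injective to fsuc-injective)
open import Data.List using (List; []; _∷_; _++_; map; tabulate)
open import Data.List.Properties using (map-tabulate)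
open import Data.List.Relation.Unary.Any as Any using (Any; here; there)
open import Data.List.Relation.Unary.All as All using (All; []; _∷_)
open import Data.List.Relation.Unary.All.Properties using (All¬⇒¬Any)
open import Data.List.Relation.Unary.AllPairs using (AllPairs; []; _∷_)
open import Data.List.Relation.Binary.Permutation.Propositional as ↭
  using (_↭_; ↭-refl; ↭-prep; ↭-swap; ↭-trans; ↭-sym; ↭⇒↭ₛ)
open import Data.List.Relation.Binary.Permutation.Propositional.Properties using (All-resp-↭; Any-resp-↭; map⁺; shift)
import Data.List.Relation.Binary.Permutation.Setoid.Properties as PermutationSetoid
open import Data.Nat using (ℕ; zero; suc; _+_; _∸_; _≤_; _<_; z≤n; s≤s; _≡ᵇ_)
open import Data.Nat.Induction using (<-wellFounded)
open import Data.Nat.ListAction using (sum)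
open import Data.Nat.ListAction.Properties using (sum-↭)
open import Data.Nat.Properties
open import Data.Product using (Σ-syntax; _×_; _,_; proj₁; proj₂)
open import Data.Product.Function.NonDependent.Propositional using (_×-⇔_)
import Data.Sum as Sum
open import Data.Sum using (_⊎_; inj₁; inj₂)
open import Data.Sum.Function.Propositional using (_⊎-⇔_)
open import Function using (_∘_)
open import Function.Bundles using (_⇔_; mk⇔; Equivalence)
open import Function.Properties.Equivalence using (⇔-setoid) renaming (trans to ⇔-trans)
open import Function.Related.TypeIsomorphisms using (¬-cong-⇔)
open import Induction.WellFounded using (Acc; acc)
open import Level using (0ℓ)
open import Relation.Binary.Definitions using (tri<; tri≈; tri>)
open import Relation.Binary.PropositionalEquality
open import Relation.Nullary using (¬_; yes; no)
open import Relation.Nullary.Decidable using (⌊_⌋; True; toWitness; fromWitness; toWitnessFalse; fromWitnessFalse)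

open Equivalence using (to; from)

if-T≡1 : ∀ {b} → T b → (if b then 1 else 0) ≡ 1
if-T≡1 {true} _ = refl

if-¬T≡0 : ∀ {b} → ¬ T b → (if b then 1 else 0) ≡ 0
if-¬T≡0 {false} _ = refl
if-¬T≡0 {true}  ¬t = ⊥-elim (¬t _)

T-not : ∀ {b} → T (not b) ⇔ (¬ T b)
T-not {false} = mk⇔ (λ _ ()) (λ _ → _)
T-not {true}  = mk⇔ (λ ()) (λ ¬t → ¬t _)

1≤if⇒T : ∀ {b} → 1 ≤ (if b then 1 else 0) → T b
1≤if⇒T {true} _ = _

Any-↭ : {A : Set} {P : A → Set} {as : List A} → Any P as → Σ[ a ∈ A ] Σ[ bs ∈ List A ] (as ↭ a ∷ bs) × P a
Any-↭ (here p)  = _ , _ , ↭-refl , p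
Any-↭ {as = b ∷ _} (there q) with Any-↭ q
... | a , bs , as↭ , p = a , b ∷ bs , ↭-trans (↭-prep b as↭) (↭-swap b a ↭-refl) , p

-- Degrees and deletions

sum-tabulate≡0 : ∀ {n} (h : Fin n → ℕ) → (∀ i → h i ≡ 0) → sum (tabulate h) ≡ 0
sum-tabulate≡0 {zero}  h h≡0 = refl
sum-tabulate≡0 {suc n} h h≡0 = cong₂ _+_ (h≡0 fzero) (sum-tabulate≡0 (h ∘ fsuc) (h≡0 ∘ fsuc))

sum-tabulate≡ : ∀ {n} (h : Fin n → ℕ) i → (∀ j → j ≢ i → h j ≡ 0) → sum (tabulate h) ≡ h i
sum-tabulate≡ h fzero others =
  trans (cong (h fzero +_) (sum-tabulate≡0 (h ∘ fsuc) (λ j → others (fsuc j) λ ()))) (+-identityʳ _)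
sum-tabulate≡ h (fsuc i) others =
  cong₂ _+_ (others fzero λ ()) (sum-tabulate≡ (h ∘ fsuc) i (λ j j≢i → others (fsuc j) (j≢i ∘ fsuc-injective)))

sum-tabulate-≥ : ∀ {n} (h : Fin n → ℕ) i → h i ≤ sum (tabulate h)
sum-tabulate-≥ h fzero    = m≤m+n _ _
sum-tabulate-≥ h (fsuc i) = ≤-trans (sum-tabulate-≥ (h ∘ fsuc) i) (m≤n+m _ _)

module _ {n} (G : Graph n) (v : Fin n) where

  degree-tabulate : degree G v ≡ sum (tabulate (λ w → if adj G v w then 1 else 0))
  degree-tabulate = cong sum (map-tabulate (λ w → w) (λ w → if adj G v w then 1 else 0))

  degree≡0 : (∀ w → ¬ T (adj G v w)) → degree G v ≡ 0
  degree≡0 none = trans degree-tabulate (sum-tabulate≡0 _ (if-¬T≡0 ∘ none))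

  degree≡1 : ∀ {w} → T (adj G v w) → (∀ w′ → T (adj G v w′) → w′ ≡ w) → degree G v ≡ 1
  degree≡1 {w} v~w only = begin
    degree G v                                         ≡⟨ degree-tabulate ⟩
    sum (tabulate (λ w′ → if adj G v w′ then 1 else 0)) ≡⟨ sum-tabulate≡ _ w (λ w′ w′≢w → if-¬T≡0 (w′≢w ∘ only w′)) ⟩
    (if adj G v w then 1 else 0)                       ≡⟨ if-T≡1 v~w ⟩
    1                                                  ∎
    where open ≡-Reasoning

  degree≢0 : ∀ {w} → T (adj G v w) → degree G v ≢ 0
  degree≢0 {w} v~w deg≡0 = 1+n≰n (begin
    1                                                   ≡⟨ if-T≡1 v~w ⟨
    (if adj G v w then 1 else 0)                        ≤⟨ sum-tabulate-≥ _ w ⟩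
    sum (tabulate (λ w′ → if adj G v w′ then 1 else 0)) ≡⟨ trans (sym degree-tabulate) deg≡0 ⟩
    0                                                   ∎)
    where open ≤-Reasoning

module _ {n} {G : Graph n} where

  present-deleteVertex : ∀ {v u} → T (present (deleteVertex G v) u) ⇔ (T (present G u) × u ≢ v)
  present-deleteVertex = mk⇔
    (λ t → let p , q = to T-∧ t in p , toWitnessFalse q)
    (λ (p , u≢v) → from T-∧ (p , fromWitnessFalse u≢v))

  adj-deleteVertex : ∀ {v u w} → T (adj (deleteVertex G v) u w) ⇔ (T (adj G u w) × u ≢ v × w ≢ v)
  adj-deleteVertex {v} {u} {w} = mk⇔
    (λ t → let a , t′ = to (T-∧ {adj G u w}) t; p , q = to (T-∧ {not ⌊ u Fin.≟ v ⌋}) t′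
           in a , toWitnessFalse p , toWitnessFalse q)
    (λ (a , u≢v , w≢v) → from (T-∧ {adj G u w}) (a , from (T-∧ {not ⌊ u Fin.≟ v ⌋})
                                                      (fromWitnessFalse u≢v , fromWitnessFalse w≢v)))

  adj-deleteEdge : ∀ {a b u w} →
    T (adj (deleteEdge G a b) u w) ⇔ (T (adj G u w) × ¬ ((u ≡ a × w ≡ b) ⊎ (u ≡ b × w ≡ a)))
  adj-deleteEdge {a} {b} {u} {w} = mk⇔
    (λ t → let e , t′ = to T-∧ t in e , λ ends → to T-not t′ (from T-∨ (Sum.map both-T both-T ends)))
    (λ (e , ¬ends) → from T-∧ (e , from T-not (¬ends ∘ Sum.map T-both T-both ∘ to T-∨)))
    where
    both-T : ∀ {x y p q : Fin n} → x ≡ p × y ≡ q → T (⌊ x Fin.≟ p ⌋ ∧ ⌊ y Fin.≟ q ⌋)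
    both-T {x} {y} {p} {q} (x≡p , y≡q) = from (T-∧ {⌊ x Fin.≟ p ⌋}) (fromWitness x≡p , fromWitness y≡q)
    T-both : ∀ {x y p q : Fin n} → T (⌊ x Fin.≟ p ⌋ ∧ ⌊ y Fin.≟ q ⌋) → x ≡ p × y ≡ q
    T-both {x} {y} {p} {q} t = let s , s′ = to (T-∧ {⌊ x Fin.≟ p ⌋}) t in toWitness s , toWitness s′

  deleting-sole-neighbour : ∀ {v w} → T (present G w) → w ≢ v → (∀ u → T (adj G w u) → u ≡ v) →
                            HasIsolated (deleteVertex G v)
  deleting-sole-neighbour {v} {w} pw w≢v sole =
    w , to T-≡ (from present-deleteVertex (pw , w≢v)) ,
    degree≡0 (deleteVertex G v) w (λ u t → let e , _ , u≢v = to adj-deleteVertex t in u≢v (sole u e))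

-- Segment layouts

record Segment : Set where
  constructor [_,_⟩
  field
    lo hi : ℕ
open Segment

size : Segment → ℕ
size S = hi S ∸ lo S

infix 4 _∈ᵛ_ _∈ᵉ_

_∈ᵛ_ : ℕ → Segment → Set
x ∈ᵛ S = lo S ≤ x × x < hi S

-- x ∈ᵉ S: the edge {x, x + 1} lies in S.
_∈ᵉ_ : ℕ → Segment → Set
x ∈ᵉ S = lo S ≤ x × suc x < hi S

∈ᵉ⇒∈ᵛ : ∀ {x S} → x ∈ᵉ S → x ∈ᵛ S × suc x ∈ᵛ S
∈ᵉ⇒∈ᵛ (l≤x , 1+x<h) = (l≤x , <-trans (n<1+n _) 1+x<h) , (m≤n⇒m≤1+n l≤x , 1+x<h)

Covered : List Segment → ℕ → Set
Covered segs x = Any (x ∈ᵛ_) segs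

Joined : List Segment → ℕ → Set
Joined segs x = Any (x ∈ᵉ_) segs

Adjacent : (ℕ → Set) → ℕ → ℕ → Set
Adjacent J u w = (J u × suc u ≡ w) ⊎ (J w × suc w ≡ u)

Apart : Segment → Segment → Set
Apart S T = ∀ {x} → x ∈ᵛ S → x ∈ᵛ T → ⊥

Fits : ℕ → Segment → Set
Fits n S = 2 + lo S ≤ hi S × hi S ≤ n

-- G is the disjoint union of the paths on the segments [lo, hi) of segs.
record Layout {n} (G : Graph n) (segs : List Segment) : Set where
  field
    present⇔ : ∀ v → T (present G v) ⇔ Covered segs (toℕ v)
    adj⇔     : ∀ u w → T (adj G u w) ⇔ Adjacent (Joined segs) (toℕ u) (toℕ w)
    disjoint : AllPairs Apart segs
    fits     : All (Fits n) segs
open Layout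

not-covered-elsewhere : ∀ {S R x} → AllPairs Apart (S ∷ R) → x ∈ᵛ S → ¬ Covered R x
not-covered-elsewhere (apart ∷ _) x∈S = All¬⇒¬Any (All.map (λ S#T → S#T x∈S) apart)

joined-near : ∀ {S R x} → AllPairs Apart (S ∷ R) → Joined (S ∷ R) x → x ∈ᵛ S ⊎ suc x ∈ᵛ S → x ∈ᵉ S
joined-near _        (here x∈S)    _            = x∈S
joined-near disjoint (there joined) (inj₁ x∈S)  =
  ⊥-elim (not-covered-elsewhere disjoint x∈S (Any.map (proj₁ ∘ ∈ᵉ⇒∈ᵛ) joined))
joined-near disjoint (there joined) (inj₂ 1+x∈S) =
  ⊥-elim (not-covered-elsewhere disjoint 1+x∈S (Any.map (proj₂ ∘ ∈ᵉ⇒∈ᵛ) joined))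

module _ {n} {G : Graph n} {S R} (L : Layout G (S ∷ R)) where

  lo+2≤hi : 2 + lo S ≤ hi S
  lo+2≤hi with fits L
  ... | (2+l≤h , _) ∷ _ = 2+l≤h

  hi≤n : hi S ≤ n
  hi≤n with fits L
  ... | (_ , h≤n) ∷ _ = h≤n

  rest-fits : All (Fits n) R
  rest-fits with fits L
  ... | _ ∷ fs = fs

  vertex : ∀ x → x < hi S → Fin n
  vertex x x<h = fromℕ< (<-≤-trans x<h hi≤n)

  toℕ-vertex : ∀ x x<h → toℕ (vertex x x<h) ≡ x
  toℕ-vertex x x<h = toℕ-fromℕ< _

  adjacent-within : ∀ {u w} → toℕ u ∈ᵛ S → T (adj G u w) → Adjacent (_∈ᵉ S) (toℕ u) (toℕ w)
  adjacent-within {u} {w} u∈S u~w with to (adj⇔ L u w) u~w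
  ... | inj₁ (joined , 1+u≡w) = inj₁ (joined-near (disjoint L) joined (inj₁ u∈S) , 1+u≡w)
  ... | inj₂ (joined , 1+w≡u) = inj₂ (joined-near (disjoint L) joined (inj₂ (subst (_∈ᵛ S) (sym 1+w≡u) u∈S)) , 1+w≡u)

  adj-along : ∀ {u w} x → x ∈ᵉ S → toℕ u ≡ x → toℕ w ≡ suc x → T (adj G u w) × T (adj G w u)
  adj-along x x∈S refl 1+u≡w =
    from (adj⇔ L _ _) (inj₁ (here x∈S , sym 1+u≡w)) , from (adj⇔ L _ _) (inj₂ (here x∈S , sym 1+u≡w))

  present-in-S : ∀ {u} → toℕ u ∈ᵛ S → T (present G u)
  present-in-S {u} u∈S = from (present⇔ L u) (here u∈S)

  first∈S : ∀ {x} → x ≡ lo S → x ∈ᵛ S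
  first∈S refl = ≤-refl , <-trans (n<1+n _) lo+2≤hi

  last∈S : ∀ {x} → suc x ≡ hi S → x ∈ᵛ S
  last∈S 1+x≡h = ≤-pred (≤-trans (n≤1+n _) (≤-trans lo+2≤hi (≤-reflexive (sym 1+x≡h)))) , ≤-reflexive 1+x≡h

  neighbour-of-first : ∀ {u w} → toℕ u ≡ lo S → T (adj G u w) → toℕ w ≡ suc (lo S)
  neighbour-of-first u≡l u~w with adjacent-within (first∈S u≡l) u~w
  ... | inj₁ (_ , 1+u≡w)          = trans (sym 1+u≡w) (cong suc u≡l)
  ... | inj₂ ((l≤w , _) , 1+w≡u) = ⊥-elim (1+n≰n (≤-trans (≤-reflexive (trans 1+w≡u u≡l)) l≤w))

  neighbour-of-last : ∀ {u w} → suc (toℕ u) ≡ hi S → T (adj G u w) → suc (toℕ w) ≡ toℕ u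
  neighbour-of-last 1+u≡h u~w with adjacent-within (last∈S 1+u≡h) u~w
  ... | inj₁ ((_ , 2+u≤h) , _) = ⊥-elim (1+n≰n (≤-trans 2+u≤h (≤-reflexive (sym 1+u≡h))))
  ... | inj₂ (_ , 1+w≡u)       = 1+w≡u

  upper-neighbour : ∀ {u} → toℕ u ∈ᵉ S → Σ[ w ∈ Fin n ] T (adj G u w) × toℕ w ≡ suc (toℕ u)
  upper-neighbour {u} u∈S =
    vertex (suc (toℕ u)) (proj₂ u∈S) ,
    proj₁ (adj-along (toℕ u) u∈S refl (toℕ-vertex (suc (toℕ u)) (proj₂ u∈S))) ,
    toℕ-vertex (suc (toℕ u)) (proj₂ u∈S)

  lower-neighbour : ∀ {u} → lo S < toℕ u → toℕ u < hi S → Σ[ w ∈ Fin n ] T (adj G u w) × suc (toℕ w) ≡ toℕ u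
  lower-neighbour {u} = below (toℕ u) refl
    where
    below : ∀ x → toℕ u ≡ x → lo S < x → x < hi S → Σ[ w ∈ Fin n ] T (adj G u w) × suc (toℕ w) ≡ toℕ u
    below (suc y) u≡1+y (s≤s l≤y) 1+y<h =
      vertex y y<h , proj₂ (adj-along y (l≤y , 1+y<h) (toℕ-vertex y y<h) u≡1+y) ,
      trans (cong suc (toℕ-vertex y y<h)) (sym u≡1+y)
      where
      y<h = <-trans (n<1+n y) 1+y<h

  has-neighbour : ∀ {u} → toℕ u ∈ᵛ S → Σ[ w ∈ Fin n ] T (adj G u w)
  has-neighbour {u} (l≤u , u<h) with suc (toℕ u) <? hi S
  ... | yes 1+u<h = let w , u~w , _ = upper-neighbour (l≤u , 1+u<h) in w , u~w
  ... | no  1+u≮h = let w , u~w , _ = lower-neighbour (≤-pred (≤-trans lo+2≤hi (≮⇒≥ 1+u≮h))) u<h in w , u~w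

  first-has-degree-1 : ∀ {v} → toℕ v ≡ lo S → degree G v ≡ 1
  first-has-degree-1 {v} v≡l with upper-neighbour (≤-reflexive (sym v≡l) , subst (λ x → suc x < hi S) (sym v≡l) lo+2≤hi)
  ... | w , v~w , w≡1+v =
    degree≡1 G v v~w (λ w′ v~w′ → toℕ-injective (trans (neighbour-of-first v≡l v~w′) (sym (trans w≡1+v (cong suc v≡l)))))

  last-has-degree-1 : ∀ {v} → suc (toℕ v) ≡ hi S → degree G v ≡ 1
  last-has-degree-1 {v} 1+v≡h with lower-neighbour (≤-pred (≤-trans lo+2≤hi (≤-reflexive (sym 1+v≡h)))) (proj₂ (last∈S 1+v≡h))
  ... | w , v~w , 1+w≡v =
    degree≡1 G v v~w (λ w′ v~w′ → toℕ-injective (suc-injective (trans (neighbour-of-last 1+v≡h v~w′) (sym 1+w≡v))))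

  deleting-second-isolates : ∀ {v} → toℕ v ≡ suc (lo S) → HasIsolated (deleteVertex G v)
  deleting-second-isolates {v} v≡1+l =
    deleting-sole-neighbour {G = G} (present-in-S (subst (_∈ᵛ S) (sym w≡l) (≤-refl , l<h))) (λ w≡v → 1+n≢n (trans (sym v≡1+l) (trans (cong toℕ (sym w≡v)) w≡l)))
      (λ u w~u → toℕ-injective (trans (neighbour-of-first w≡l w~u) (sym v≡1+l)))
    where
    l<h = <-trans (n<1+n _) lo+2≤hi
    w   = vertex (lo S) l<h
    w≡l = toℕ-vertex (lo S) l<h

  deleting-penultimate-isolates : ∀ {v} → suc (suc (toℕ v)) ≡ hi S → HasIsolated (deleteVertex G v)
  deleting-penultimate-isolates {v} 2+v≡h =
    deleting-sole-neighbour {G = G} (present-in-S (subst (_∈ᵛ S) (sym w≡1+v) (last∈S 2+v≡h))) (λ w≡v → 1+n≢n (trans (sym w≡1+v) (cong toℕ w≡v)))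
      (λ u w~u → toℕ-injective (suc-injective (trans (neighbour-of-last (trans (cong suc w≡1+v) 2+v≡h) w~u) w≡1+v)))
    where
    1+v<h = ≤-reflexive 2+v≡h
    w     = vertex (suc (toℕ v)) 1+v<h
    w≡1+v = toℕ-vertex (suc (toℕ v)) 1+v<h

  left-move-is-interior : ∀ {v} → toℕ v ∈ᵛ S → degree G v ≢ 1 → ¬ HasIsolated (deleteVertex G v) →
                          2 + lo S ≤ toℕ v × 3 + toℕ v ≤ hi S
  left-move-is-interior {v} (l≤v , v<h) deg≢1 ¬iso
    with toℕ v ≟ lo S | toℕ v ≟ suc (lo S) | suc (toℕ v) ≟ hi S | suc (suc (toℕ v)) ≟ hi S
  ... | yes v≡l | _         | _          | _          = ⊥-elim (deg≢1 (first-has-degree-1 v≡l))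
  ... | _       | _         | yes 1+v≡h  | _          = ⊥-elim (deg≢1 (last-has-degree-1 1+v≡h))
  ... | _       | yes v≡1+l | _          | _          = ⊥-elim (¬iso (deleting-second-isolates v≡1+l))
  ... | _       | _         | _          | yes 2+v≡h  = ⊥-elim (¬iso (deleting-penultimate-isolates 2+v≡h))
  ... | no v≢l  | no v≢1+l  | no 1+v≢h   | no 2+v≢h   =
    ≤∧≢⇒< (≤∧≢⇒< l≤v (≢-sym v≢l)) (≢-sym v≢1+l) , ≤∧≢⇒< (≤∧≢⇒< v<h 1+v≢h) 2+v≢h

adjacent-map : ∀ {J J′ : ℕ → Set} → (∀ {x} → J x → J′ x) → ∀ {u w} → Adjacent J u w → Adjacent J′ u w
adjacent-map f (inj₁ (j , e)) = inj₁ (f j , e)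
adjacent-map f (inj₂ (j , e)) = inj₂ (f j , e)

layout-↭ : ∀ {n} {G : Graph n} {segs segs′} → segs ↭ segs′ → Layout G segs → Layout G segs′
layout-↭ {segs = segs} {segs′} σ L = record
  { present⇔ = λ v → ⇔-trans (present⇔ L v) (mk⇔ (Any-resp-↭ σ) (Any-resp-↭ (↭-sym σ)))
  ; adj⇔     = λ u w → ⇔-trans (adj⇔ L u w)
                 (mk⇔ (adjacent-map {Joined segs} (Any-resp-↭ σ)) (adjacent-map {Joined segs′} (Any-resp-↭ (↭-sym σ))))
  ; disjoint = PermutationSetoid.AllPairs-resp-↭ (setoid Segment) (λ S#T {x} x∈T x∈S → S#T x∈S x∈T)
                 (resp₂ Apart) (↭⇒↭ₛ σ) (disjoint L)
  ; fits     = All-resp-↭ σ (fits L) }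

no-isolated : ∀ {n} {G : Graph n} {segs} → Layout G segs → ¬ HasIsolated G
no-isolated {G = G} L (v , present-v , degree≡0) =
  let S , R , σ , v∈S = Any-↭ (to (present⇔ L v) (from T-≡ present-v))
      w , v~w = has-neighbour (layout-↭ σ L) v∈S
  in degree≢0 G v v~w degree≡0

_⊆ˢ_ : Segment → Segment → Set
S₁ ⊆ˢ S = ∀ {x} → x ∈ᵛ S₁ → x ∈ᵛ S

disjoint-split : ∀ {S S₁ S₂ R} → S₁ ⊆ˢ S → S₂ ⊆ˢ S → Apart S₁ S₂ →
                 AllPairs Apart (S ∷ R) → AllPairs Apart (S₁ ∷ S₂ ∷ R)
disjoint-split S₁⊆S S₂⊆S S₁#S₂ (S#R ∷ R-disjoint) =
  (S₁#S₂ ∷ All.map (λ S#T {x} x∈S₁ → S#T (S₁⊆S x∈S₁)) S#R) ∷ All.map (λ S#T {x} x∈S₂ → S#T (S₂⊆S x∈S₂)) S#R ∷ R-disjoint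

module _ {R l v h} (l≤v : l ≤ v) (v<h : v < h) (disjoint : AllPairs Apart ([ l , h ⟩ ∷ R)) where

  private
    S₁ = [ l , v ⟩
    S₂ = [ suc v , h ⟩
    elsewhere : ∀ {x} → Covered R x → x ≢ v
    elsewhere c refl = not-covered-elsewhere disjoint (l≤v , v<h) c

  covered-split-vertex : ∀ {x} → Covered (S₁ ∷ S₂ ∷ R) x ⇔ (Covered ([ l , h ⟩ ∷ R) x × x ≢ v)
  covered-split-vertex = mk⇔ to′ from′
    where
    to′ : ∀ {x} → Covered (S₁ ∷ S₂ ∷ R) x → Covered ([ l , h ⟩ ∷ R) x × x ≢ v
    to′ (here (l≤x , x<v))           = here (l≤x , <-trans x<v v<h) , <⇒≢ x<v
    to′ (there (here (v<x , x<h)))   = here (≤-trans l≤v (<⇒≤ v<x) , x<h) , ≢-sym (<⇒≢ v<x)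
    to′ (there (there c))            = there c , elsewhere c
    from′ : ∀ {x} → Covered ([ l , h ⟩ ∷ R) x × x ≢ v → Covered (S₁ ∷ S₂ ∷ R) x
    from′ {x} (here (l≤x , x<h) , x≢v) with <-cmp x v
    ... | tri< x<v _ _ = here (l≤x , x<v)
    ... | tri≈ _ x≡v _ = ⊥-elim (x≢v x≡v)
    ... | tri> _ _ v<x = there (here (v<x , x<h))
    from′ (there c , _) = there (there c)

  joined-split-vertex : ∀ {x} → Joined (S₁ ∷ S₂ ∷ R) x ⇔ (Joined ([ l , h ⟩ ∷ R) x × x ≢ v × suc x ≢ v)
  joined-split-vertex = mk⇔ to′ from′
    where
    to′ : ∀ {x} → Joined (S₁ ∷ S₂ ∷ R) x → Joined ([ l , h ⟩ ∷ R) x × x ≢ v × suc x ≢ v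
    to′ (here (l≤x , 1+x<v)) =
      here (l≤x , <-trans 1+x<v v<h) , <⇒≢ (<-trans (n<1+n _) 1+x<v) , <⇒≢ 1+x<v
    to′ (there (here (v<x , 1+x<h))) =
      here (≤-trans l≤v (<⇒≤ v<x) , 1+x<h) , ≢-sym (<⇒≢ v<x) , ≢-sym (<⇒≢ (<-trans v<x (n<1+n _)))
    to′ (there (there j)) =
      there j , elsewhere (Any.map (proj₁ ∘ ∈ᵉ⇒∈ᵛ) j) , elsewhere (Any.map (proj₂ ∘ ∈ᵉ⇒∈ᵛ) j)
    from′ : ∀ {x} → Joined ([ l , h ⟩ ∷ R) x × x ≢ v × suc x ≢ v → Joined (S₁ ∷ S₂ ∷ R) x
    from′ {x} (here (l≤x , 1+x<h) , x≢v , 1+x≢v) with <-cmp x v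
    ... | tri< x<v _ _ = here (l≤x , ≤∧≢⇒< x<v 1+x≢v)
    ... | tri≈ _ x≡v _ = ⊥-elim (x≢v x≡v)
    ... | tri> _ _ v<x = there (here (v<x , 1+x<h))
    from′ (there j , _) = there (there j)

module _ {R l p h} (l≤p : l ≤ p) (1+p<h : suc p < h) (disjoint : AllPairs Apart ([ l , h ⟩ ∷ R)) where

  private
    S₁ = [ l , suc p ⟩
    S₂ = [ suc p , h ⟩

  covered-split-edge : ∀ {x} → Covered (S₁ ∷ S₂ ∷ R) x ⇔ Covered ([ l , h ⟩ ∷ R) x
  covered-split-edge = mk⇔ to′ from′
    where
    to′ : ∀ {x} → Covered (S₁ ∷ S₂ ∷ R) x → Covered ([ l , h ⟩ ∷ R) x
    to′ (here (l≤x , x<1+p))        = here (l≤x , <-trans x<1+p 1+p<h)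
    to′ (there (here (p<x , x<h)))  = here (≤-trans l≤p (<⇒≤ p<x) , x<h)
    to′ (there (there c))           = there c
    from′ : ∀ {x} → Covered ([ l , h ⟩ ∷ R) x → Covered (S₁ ∷ S₂ ∷ R) x
    from′ {x} (here (l≤x , x<h)) with x ≤? p
    ... | yes x≤p = here (l≤x , s≤s x≤p)
    ... | no  x≰p = there (here (≰⇒> x≰p , x<h))
    from′ (there c) = there (there c)

  joined-split-edge : ∀ {x} → Joined (S₁ ∷ S₂ ∷ R) x ⇔ (Joined ([ l , h ⟩ ∷ R) x × x ≢ p)
  joined-split-edge = mk⇔ to′ from′
    where
    to′ : ∀ {x} → Joined (S₁ ∷ S₂ ∷ R) x → Joined ([ l , h ⟩ ∷ R) x × x ≢ p
    to′ (here (l≤x , 1+x<1+p))       = here (l≤x , <-trans 1+x<1+p 1+p<h) , <⇒≢ (≤-pred 1+x<1+p)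
    to′ (there (here (p<x , 1+x<h))) = here (≤-trans l≤p (<⇒≤ p<x) , 1+x<h) , ≢-sym (<⇒≢ p<x)
    to′ (there (there j))           = there j , λ { refl → not-covered-elsewhere disjoint (l≤p , <-trans (n<1+n _) 1+p<h)
                                                           (Any.map (proj₁ ∘ ∈ᵉ⇒∈ᵛ) j) }
    from′ : ∀ {x} → Joined ([ l , h ⟩ ∷ R) x × x ≢ p → Joined (S₁ ∷ S₂ ∷ R) x
    from′ {x} (here (l≤x , 1+x<h) , x≢p) with <-cmp x p
    ... | tri< x<p _ _ = here (l≤x , s≤s x<p)
    ... | tri≈ _ x≡p _ = ⊥-elim (x≢p x≡p)
    ... | tri> _ _ p<x = there (here (p<x , 1+x<h))
    from′ (there j , _) = there (there j)

module _ {J J′ : ℕ → Set} where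

  adjacent-without-vertex : ∀ {v} → (∀ {x} → J′ x ⇔ (J x × x ≢ v × suc x ≢ v)) →
                            ∀ {u w} → Adjacent J′ u w ⇔ (Adjacent J u w × u ≢ v × w ≢ v)
  adjacent-without-vertex {v} J′⇔ = mk⇔ to′ from′
    where
    to′ : ∀ {u w} → Adjacent J′ u w → Adjacent J u w × u ≢ v × w ≢ v
    to′ (inj₁ (j′ , refl)) = let j , u≢v , 1+u≢v = to J′⇔ j′ in inj₁ (j , refl) , u≢v , 1+u≢v
    to′ (inj₂ (j′ , refl)) = let j , w≢v , 1+w≢v = to J′⇔ j′ in inj₂ (j , refl) , 1+w≢v , w≢v
    from′ : ∀ {u w} → Adjacent J u w × u ≢ v × w ≢ v → Adjacent J′ u w
    from′ (inj₁ (j , refl) , u≢v , w≢v) = inj₁ (from J′⇔ (j , u≢v , w≢v) , refl)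
    from′ (inj₂ (j , refl) , u≢v , w≢v) = inj₂ (from J′⇔ (j , w≢v , u≢v) , refl)

  adjacent-without-edge : ∀ {p} → (∀ {x} → J′ x ⇔ (J x × x ≢ p)) →
                          ∀ {u w} → Adjacent J′ u w ⇔ (Adjacent J u w × ¬ ((u ≡ p × w ≡ suc p) ⊎ (u ≡ suc p × w ≡ p)))
  adjacent-without-edge {p} J′⇔ = mk⇔ to′ from′
    where
    Ends : ℕ → ℕ → Set
    Ends u w = (u ≡ p × w ≡ suc p) ⊎ (u ≡ suc p × w ≡ p)
    to′ : ∀ {u w} → Adjacent J′ u w → Adjacent J u w × ¬ Ends u w
    to′ (inj₁ (j′ , refl)) = let j , u≢p = to J′⇔ j′ in inj₁ (j , refl) , λ
      { (inj₁ (u≡p , _))      → u≢p u≡p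
      ; (inj₂ (refl , 2+p≡p)) → m+1+n≢n 1 2+p≡p }
    to′ (inj₂ (j′ , refl)) = let j , w≢p = to J′⇔ j′ in inj₂ (j , refl) , λ
      { (inj₁ (2+p≡p , refl)) → m+1+n≢n 1 2+p≡p
      ; (inj₂ (_ , w≡p))      → w≢p w≡p }
    from′ : ∀ {u w} → Adjacent J u w × ¬ Ends u w → Adjacent J′ u w
    from′ (inj₁ (j , refl) , ¬ends) = inj₁ (from J′⇔ (j , λ { refl → ¬ends (inj₁ (refl , refl)) }) , refl)
    from′ (inj₂ (j , refl) , ¬ends) = inj₂ (from J′⇔ (j , λ { refl → ¬ends (inj₂ (refl , refl)) }) , refl)

≢⇔toℕ≢ : ∀ {n} {u v : Fin n} → (u ≢ v) ⇔ (toℕ u ≢ toℕ v)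
≢⇔toℕ≢ = mk⇔ (λ u≢v → u≢v ∘ toℕ-injective) (λ ne → ne ∘ cong toℕ)

module _ {n} {G : Graph n} {R l h} (L : Layout G ([ l , h ⟩ ∷ R)) where

  open import Relation.Binary.Reasoning.Setoid (⇔-setoid 0ℓ)

  layout-deleteVertex : ∀ {v} → 2 + l ≤ toℕ v → 3 + toℕ v ≤ h →
                        Layout (deleteVertex G v) ([ l , toℕ v ⟩ ∷ [ suc (toℕ v) , h ⟩ ∷ R)
  layout-deleteVertex {v} 2+l≤v 3+v≤h = record
    { present⇔ = λ u → begin
        T (present (deleteVertex G v) u)         ≈⟨ present-deleteVertex {G = G} ⟩
        (T (present G u) × u ≢ v)                ≈⟨ present⇔ L u ×-⇔ ≢⇔toℕ≢ ⟩
        (Covered ([ l , h ⟩ ∷ R) (toℕ u) × toℕ u ≢ toℕ v) ≈⟨ covered-split-vertex l≤v v<h (disjoint L) ⟨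
        Covered new (toℕ u)                      ∎
    ; adj⇔ = λ u w → begin
        T (adj (deleteVertex G v) u w)           ≈⟨ adj-deleteVertex {G = G} ⟩
        (T (adj G u w) × u ≢ v × w ≢ v)          ≈⟨ adj⇔ L u w ×-⇔ ≢⇔toℕ≢ ×-⇔ ≢⇔toℕ≢ ⟩
        (Adjacent (Joined ([ l , h ⟩ ∷ R)) (toℕ u) (toℕ w) × toℕ u ≢ toℕ v × toℕ w ≢ toℕ v)
                                                 ≈⟨ adjacent-without-vertex (joined-split-vertex l≤v v<h (disjoint L)) ⟨
        Adjacent (Joined new) (toℕ u) (toℕ w)    ∎
    ; disjoint = disjoint-split (λ (l≤x , x<v) → l≤x , <-trans x<v v<h)
                                (λ (v<x , x<h) → ≤-trans l≤v (<⇒≤ v<x) , x<h)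
                                (λ (_ , x<v) (v<x , _) → <-asym x<v v<x) (disjoint L)
    ; fits = (2+l≤v , ≤-trans (<⇒≤ v<h) (hi≤n L)) ∷ (3+v≤h , hi≤n L) ∷ rest-fits L }
    where
    new = [ l , toℕ v ⟩ ∷ [ suc (toℕ v) , h ⟩ ∷ R
    l≤v : l ≤ toℕ v
    l≤v = ≤-trans (≤-trans (n≤1+n _) (n≤1+n _)) 2+l≤v
    v<h : toℕ v < h
    v<h = ≤-trans (≤-trans (n≤1+n _) (n≤1+n _)) 3+v≤h

  layout-deleteEdge : ∀ {p a b} → 2 + l ≤ suc p → 2 + suc p ≤ h → toℕ a ≡ p → toℕ b ≡ suc p →
                      Layout (deleteEdge G a b) ([ l , suc p ⟩ ∷ [ suc p , h ⟩ ∷ R)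
  layout-deleteEdge {p} {a} {b} 2+l≤1+p 3+p≤h a≡p b≡1+p = record
    { present⇔ = λ u → begin
        T (present G u)                          ≈⟨ present⇔ L u ⟩
        Covered ([ l , h ⟩ ∷ R) (toℕ u)          ≈⟨ covered-split-edge l≤p 1+p<h (disjoint L) ⟨
        Covered new (toℕ u)                      ∎
    ; adj⇔ = λ u w → begin
        T (adj (deleteEdge G a b) u w)           ≈⟨ adj-deleteEdge {G = G} ⟩
        (T (adj G u w) × ¬ ((u ≡ a × w ≡ b) ⊎ (u ≡ b × w ≡ a)))
            ≈⟨ adj⇔ L u w ×-⇔ ¬-cong-⇔ ((≡⇔toℕ≡ a≡p ×-⇔ ≡⇔toℕ≡ b≡1+p) ⊎-⇔ (≡⇔toℕ≡ b≡1+p ×-⇔ ≡⇔toℕ≡ a≡p)) ⟩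
        (Adjacent (Joined ([ l , h ⟩ ∷ R)) (toℕ u) (toℕ w) ×
         ¬ ((toℕ u ≡ p × toℕ w ≡ suc p) ⊎ (toℕ u ≡ suc p × toℕ w ≡ p)))
            ≈⟨ adjacent-without-edge (joined-split-edge l≤p 1+p<h (disjoint L)) ⟨
        Adjacent (Joined new) (toℕ u) (toℕ w)    ∎
    ; disjoint = disjoint-split (λ (l≤x , x<1+p) → l≤x , <-trans x<1+p 1+p<h)
                                (λ (p<x , x<h) → ≤-trans l≤p (<⇒≤ p<x) , x<h)
                                (λ (_ , x<1+p) (p<x , _) → <⇒≱ p<x (≤-pred x<1+p)) (disjoint L)
    ; fits = (2+l≤1+p , ≤-trans (<⇒≤ 1+p<h) (hi≤n L)) ∷ (3+p≤h , hi≤n L) ∷ rest-fits L }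
    where
    new = [ l , suc p ⟩ ∷ [ suc p , h ⟩ ∷ R
    1+p<h : suc p < h
    1+p<h = ≤-trans (n≤1+n _) 3+p≤h
    l≤p : l ≤ p
    l≤p = ≤-pred (≤-trans (n≤1+n _) 2+l≤1+p)
    ≡⇔toℕ≡ : ∀ {u x y} → toℕ x ≡ y → (u ≡ x) ⇔ (toℕ u ≡ y)
    ≡⇔toℕ≡ refl = mk⇔ (cong toℕ) toℕ-injective

  right-cut : ∀ {m} → 2 + l ≤ m → 2 + m ≤ h →
              Σ[ G′ ∈ Graph n ] RightMove G G′ × Layout G′ ([ l , m ⟩ ∷ [ m , h ⟩ ∷ R)
  right-cut {suc p} 2+l≤1+p 3+p≤h = deleteEdge G a b , delE a b (to T-≡ a~b) (no-isolated L′) , L′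
    where
    1+p<h = ≤-trans (n≤1+n _) 3+p≤h
    p<h   = <-trans (n<1+n p) 1+p<h
    a = vertex L p p<h
    b = vertex L (suc p) 1+p<h
    a~b = proj₁ (adj-along L p (≤-pred (≤-trans (n≤1+n _) 2+l≤1+p) , 1+p<h) (toℕ-vertex L p p<h) (toℕ-vertex L (suc p) 1+p<h))
    L′ = layout-deleteEdge 2+l≤1+p 3+p≤h (toℕ-vertex L p p<h) (toℕ-vertex L (suc p) 1+p<h)

path-layout : ∀ n → 2 ≤ n → Layout (path n) ([ 0 , n ⟩ ∷ [])
path-layout n 2≤n = record
  { present⇔ = λ v → mk⇔ (λ _ → here (z≤n , toℕ<n v)) (λ _ → _)
  ; adj⇔     = λ u w → mk⇔ (to′ u w) (from′ u w)
  ; disjoint = [] ∷ []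
  ; fits     = (2≤n , ≤-refl) ∷ [] }
  where
  to′ : ∀ u w → T (⌊ suc (toℕ u) ≟ toℕ w ⌋ ∨ ⌊ suc (toℕ w) ≟ toℕ u ⌋) →
        Adjacent (Joined ([ 0 , n ⟩ ∷ [])) (toℕ u) (toℕ w)
  to′ u w t with to (T-∨ {⌊ suc (toℕ u) ≟ toℕ w ⌋}) t
  ... | inj₁ t′ = let e = toWitness t′ in inj₁ (here (z≤n , subst (_< n) (sym e) (toℕ<n w)) , e)
  ... | inj₂ t′ = let e = toWitness t′ in inj₂ (here (z≤n , subst (_< n) (sym e) (toℕ<n u)) , e)
  from′ : ∀ u w → Adjacent (Joined ([ 0 , n ⟩ ∷ [])) (toℕ u) (toℕ w) →
          T (⌊ suc (toℕ u) ≟ toℕ w ⌋ ∨ ⌊ suc (toℕ w) ≟ toℕ u ⌋)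
  from′ u w (inj₁ (_ , e)) = from (T-∨ {⌊ suc (toℕ u) ≟ toℕ w ⌋}) (inj₁ (fromWitness e))
  from′ u w (inj₂ (_ , e)) = from (T-∨ {⌊ suc (toℕ u) ≟ toℕ w ⌋}) (inj₂ (fromWitness e))

-- Tallies of path lengths and safe positions

-- Multiplicities of the path lengths 4, 5, 6, 7, 8 and 11; no other length matters for safety.
record Tally : Set where
  constructor counts
  field
    n₄ n₅ n₆ n₇ n₈ n₁₁ : ℕ
open Tally

infixr 6 _⊕_

_⊕_ : Tally → Tally → Tally
X ⊕ Y = counts (n₄ X + n₄ Y) (n₅ X + n₅ Y) (n₆ X + n₆ Y) (n₇ X + n₇ Y) (n₈ X + n₈ Y) (n₁₁ X + n₁₁ Y)

𝟘 : Tally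
𝟘 = counts 0 0 0 0 0 0

⟦_⟧ : ℕ → Tally
⟦ x ⟧ = counts (δ 4) (δ 5) (δ 6) (δ 7) (δ 8) (δ 11)
  where
  δ : ℕ → ℕ
  δ y = if x ≡ᵇ y then 1 else 0

Tally-≡ : ∀ {X Y} → n₄ X ≡ n₄ Y → n₅ X ≡ n₅ Y → n₆ X ≡ n₆ Y → n₇ X ≡ n₇ Y →
          n₈ X ≡ n₈ Y → n₁₁ X ≡ n₁₁ Y → X ≡ Y
Tally-≡ refl refl refl refl refl refl = refl

⊕-assoc : ∀ X Y Z → (X ⊕ Y) ⊕ Z ≡ X ⊕ (Y ⊕ Z)
⊕-assoc X Y Z = Tally-≡ (+-assoc (n₄ X) _ _) (+-assoc (n₅ X) _ _) (+-assoc (n₆ X) _ _)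
                        (+-assoc (n₇ X) _ _) (+-assoc (n₈ X) _ _) (+-assoc (n₁₁ X) _ _)

⊕-comm : ∀ X Y → X ⊕ Y ≡ Y ⊕ X
⊕-comm X Y = Tally-≡ (+-comm (n₄ X) _) (+-comm (n₅ X) _) (+-comm (n₆ X) _)
                     (+-comm (n₇ X) _) (+-comm (n₈ X) _) (+-comm (n₁₁ X) _)

⊕-cancelˡ : ∀ X {Y Z} → X ⊕ Y ≡ X ⊕ Z → Y ≡ Z
⊕-cancelˡ X e = Tally-≡ (+-cancelˡ-≡ (n₄ X) _ _ (cong n₄ e)) (+-cancelˡ-≡ (n₅ X) _ _ (cong n₅ e))
                        (+-cancelˡ-≡ (n₆ X) _ _ (cong n₆ e)) (+-cancelˡ-≡ (n₇ X) _ _ (cong n₇ e))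
                        (+-cancelˡ-≡ (n₈ X) _ _ (cong n₈ e)) (+-cancelˡ-≡ (n₁₁ X) _ _ (cong n₁₁ e))

x⊕y⊕z≡y⊕x⊕z : ∀ X Y Z → X ⊕ Y ⊕ Z ≡ Y ⊕ X ⊕ Z
x⊕y⊕z≡y⊕x⊕z X Y Z = begin
  X ⊕ Y ⊕ Z   ≡⟨ ⊕-assoc X Y Z ⟨
  (X ⊕ Y) ⊕ Z ≡⟨ cong (_⊕ Z) (⊕-comm X Y) ⟩
  (Y ⊕ X) ⊕ Z ≡⟨ ⊕-assoc Y X Z ⟩
  Y ⊕ X ⊕ Z   ∎
  where open ≡-Reasoning

Σᵀ : {A : Set} → (A → Tally) → List A → Tally
Σᵀ f []       = 𝟘
Σᵀ f (a ∷ as) = f a ⊕ Σᵀ f as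

module _ {A : Set} (f : A → Tally) where

  Σᵀ-++ : ∀ as bs → Σᵀ f (as ++ bs) ≡ Σᵀ f as ⊕ Σᵀ f bs
  Σᵀ-++ []       bs = refl
  Σᵀ-++ (a ∷ as) bs = trans (cong (f a ⊕_) (Σᵀ-++ as bs)) (sym (⊕-assoc (f a) _ _))

  Σᵀ-↭ : ∀ {as bs} → as ↭ bs → Σᵀ f as ≡ Σᵀ f bs
  Σᵀ-↭ ↭.refl         = refl
  Σᵀ-↭ (↭.prep a p)   = cong (f a ⊕_) (Σᵀ-↭ p)
  Σᵀ-↭ (↭.swap a b p) = trans (x⊕y⊕z≡y⊕x⊕z (f a) (f b) _) (cong (λ Z → f b ⊕ f a ⊕ Z) (Σᵀ-↭ p))
  Σᵀ-↭ (↭.trans p q)  = trans (Σᵀ-↭ p) (Σᵀ-↭ q)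

data Special : ℕ → Set where
  four  : Special 4
  five  : Special 5
  six   : Special 6
  seven : Special 7
  eight : Special 8
  eleven : Special 11

multiplicity : ∀ {x} → Special x → Tally → ℕ
multiplicity four   = n₄
multiplicity five   = n₅
multiplicity six    = n₆
multiplicity seven  = n₇
multiplicity eight  = n₈
multiplicity eleven = n₁₁

multiplicity-⊕ : ∀ {x} (σ : Special x) X Y → multiplicity σ (X ⊕ Y) ≡ multiplicity σ X + multiplicity σ Y
multiplicity-⊕ four   X Y = refl
multiplicity-⊕ five   X Y = refl
multiplicity-⊕ six    X Y = refl
multiplicity-⊕ seven  X Y = refl
multiplicity-⊕ eight  X Y = refl
multiplicity-⊕ eleven X Y = refl

multiplicity-𝟘 : ∀ {x} (σ : Special x) → multiplicity σ 𝟘 ≡ 0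
multiplicity-𝟘 four   = refl
multiplicity-𝟘 five   = refl
multiplicity-𝟘 six    = refl
multiplicity-𝟘 seven  = refl
multiplicity-𝟘 eight  = refl
multiplicity-𝟘 eleven = refl

multiplicity-self : ∀ {x W} (σ : Special x) → 1 ≤ multiplicity σ (⟦ x ⟧ ⊕ W)
multiplicity-self four   = s≤s z≤n
multiplicity-self five   = s≤s z≤n
multiplicity-self six    = s≤s z≤n
multiplicity-self seven  = s≤s z≤n
multiplicity-self eight  = s≤s z≤n
multiplicity-self eleven = s≤s z≤n

multiplicity-⟦⟧ : ∀ {x} (σ : Special x) y → 1 ≤ multiplicity σ ⟦ y ⟧ → y ≡ x
multiplicity-⟦⟧ {x} σ y 1≤ = ≡ᵇ⇒≡ y x (1≤if⇒T (subst (1 ≤_) (coordinate σ) 1≤))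
  where
  coordinate : ∀ {x} (σ : Special x) → multiplicity σ ⟦ y ⟧ ≡ (if y ≡ᵇ x then 1 else 0)
  coordinate four   = refl
  coordinate five   = refl
  coordinate six    = refl
  coordinate seven  = refl
  coordinate eight  = refl
  coordinate eleven = refl

Σᵀ-witness : ∀ {A : Set} (f : A → Tally) {x} (σ : Special x) as →
             1 ≤ multiplicity σ (Σᵀ f as) → Any (λ a → 1 ≤ multiplicity σ (f a)) as
Σᵀ-witness f σ [] 1≤ = ⊥-elim (1+n≰n (subst (1 ≤_) (multiplicity-𝟘 σ) 1≤))
Σᵀ-witness f σ (a ∷ as) 1≤ with multiplicity σ (f a) in eq
... | suc _ = here (subst (1 ≤_) (sym eq) (s≤s z≤n))
... | zero  = there (Σᵀ-witness f σ as (subst (1 ≤_) (trans (multiplicity-⊕ σ (f a) _) (cong (_+ _) eq)) 1≤))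

data Block : Set where
  ⟨4⟩ ⟨8⟩ ⟨4,5⟩ ⟨4,6⟩ ⟨4,7⟩ ⟨4,11⟩ ⟨8,11⟩ ⟨4,5,7⟩ : Block

⟦_⟧ᴮ : Block → Tally
⟦ ⟨4⟩ ⟧ᴮ    = ⟦ 4 ⟧
⟦ ⟨8⟩ ⟧ᴮ    = ⟦ 8 ⟧
⟦ ⟨4,5⟩ ⟧ᴮ  = ⟦ 4 ⟧ ⊕ ⟦ 5 ⟧
⟦ ⟨4,6⟩ ⟧ᴮ  = ⟦ 4 ⟧ ⊕ ⟦ 6 ⟧
⟦ ⟨4,7⟩ ⟧ᴮ  = ⟦ 4 ⟧ ⊕ ⟦ 7 ⟧
⟦ ⟨4,11⟩ ⟧ᴮ = ⟦ 4 ⟧ ⊕ ⟦ 11 ⟧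
⟦ ⟨8,11⟩ ⟧ᴮ = ⟦ 8 ⟧ ⊕ ⟦ 11 ⟧
⟦ ⟨4,5,7⟩ ⟧ᴮ = ⟦ 4 ⟧ ⊕ ⟦ 5 ⟧ ⊕ ⟦ 7 ⟧

SafeBut : Tally → Tally → Set
SafeBut ρ V = Σ[ βs ∈ List Block ] V ≡ ρ ⊕ Σᵀ ⟦_⟧ᴮ βs

Safe : Tally → Set
Safe V = Σ[ βs ∈ List Block ] V ≡ Σᵀ ⟦_⟧ᴮ βs

safe-𝟘 : Safe 𝟘
safe-𝟘 = [] , refl

safe-⊕ : ∀ {V W} → Safe V → Safe W → Safe (V ⊕ W)
safe-⊕ (βs , refl) (γs , refl) = βs ++ γs , sym (Σᵀ-++ ⟦_⟧ᴮ βs γs)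

block-containing : ∀ {x W} (σ : Special x) → Safe (⟦ x ⟧ ⊕ W) →
                   Σ[ β ∈ Block ] 1 ≤ multiplicity σ ⟦ β ⟧ᴮ × SafeBut ⟦ β ⟧ᴮ (⟦ x ⟧ ⊕ W)
block-containing σ (βs , e) with Any-↭ (Σᵀ-witness ⟦_⟧ᴮ σ βs (subst (λ V → 1 ≤ multiplicity σ V) e (multiplicity-self σ)))
... | β , γs , βs↭ , 1≤β = β , 1≤β , γs , trans e (Σᵀ-↭ ⟦_⟧ᴮ βs↭)

partner-of-5 : ∀ {W} → Safe (⟦ 5 ⟧ ⊕ W) → SafeBut ⟦ 4 ⟧ W ⊎ SafeBut (⟦ 4 ⟧ ⊕ ⟦ 7 ⟧) W
partner-of-5 s with block-containing five s
... | ⟨4,5⟩  , _ , γs , e = inj₁ (γs , ⊕-cancelˡ ⟦ 5 ⟧ e)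
... | ⟨4,5,7⟩ , _ , γs , e = inj₂ (γs , ⊕-cancelˡ ⟦ 5 ⟧ e)
... | ⟨4⟩    , () , _
... | ⟨8⟩    , () , _
... | ⟨4,6⟩  , () , _
... | ⟨4,7⟩  , () , _
... | ⟨4,11⟩ , () , _
... | ⟨8,11⟩ , () , _

partner-of-6 : ∀ {W} → Safe (⟦ 6 ⟧ ⊕ W) → SafeBut ⟦ 4 ⟧ W
partner-of-6 s with block-containing six s
... | ⟨4,6⟩  , _ , γs , e = γs , ⊕-cancelˡ ⟦ 6 ⟧ e
... | ⟨4⟩    , () , _
... | ⟨8⟩    , () , _
... | ⟨4,5⟩  , () , _
... | ⟨4,7⟩  , () , _
... | ⟨4,11⟩ , () , _
... | ⟨8,11⟩ , () , _
... | ⟨4,5,7⟩ , () , _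

partner-of-7 : ∀ {W} → Safe (⟦ 7 ⟧ ⊕ W) → SafeBut ⟦ 4 ⟧ W ⊎ SafeBut (⟦ 4 ⟧ ⊕ ⟦ 5 ⟧) W
partner-of-7 s with block-containing seven s
... | ⟨4,7⟩  , _ , γs , e = inj₁ (γs , ⊕-cancelˡ ⟦ 7 ⟧ e)
... | ⟨4,5,7⟩ , _ , γs , e = inj₂ (γs , ⊕-cancelˡ ⟦ 7 ⟧ e)
... | ⟨4⟩    , () , _
... | ⟨8⟩    , () , _
... | ⟨4,5⟩  , () , _
... | ⟨4,6⟩  , () , _
... | ⟨4,11⟩ , () , _
... | ⟨8,11⟩ , () , _

partner-of-8 : ∀ {W} → Safe (⟦ 8 ⟧ ⊕ W) → Safe W ⊎ SafeBut ⟦ 11 ⟧ W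
partner-of-8 s with block-containing eight s
... | ⟨8⟩    , _ , γs , e = inj₁ (γs , ⊕-cancelˡ ⟦ 8 ⟧ e)
... | ⟨8,11⟩ , _ , γs , e = inj₂ (γs , ⊕-cancelˡ ⟦ 8 ⟧ e)
... | ⟨4⟩    , () , _
... | ⟨4,5⟩  , () , _
... | ⟨4,6⟩  , () , _
... | ⟨4,7⟩  , () , _
... | ⟨4,11⟩ , () , _
... | ⟨4,5,7⟩ , () , _

partner-of-11 : ∀ {W} → Safe (⟦ 11 ⟧ ⊕ W) → SafeBut ⟦ 4 ⟧ W ⊎ SafeBut ⟦ 8 ⟧ W
partner-of-11 s with block-containing eleven s
... | ⟨4,11⟩ , _ , γs , e = inj₁ (γs , ⊕-cancelˡ ⟦ 11 ⟧ e)
... | ⟨8,11⟩ , _ , γs , e = inj₂ (γs , ⊕-cancelˡ ⟦ 11 ⟧ e)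
... | ⟨4⟩    , () , _
... | ⟨8⟩    , () , _
... | ⟨4,5⟩  , () , _
... | ⟨4,6⟩  , () , _
... | ⟨4,7⟩  , () , _
... | ⟨4,5,7⟩ , () , _

infixr 5 _∷ˢ_

_∷ˢ_ : ∀ β {W} → Safe W → Safe (⟦ β ⟧ᴮ ⊕ W)
β ∷ˢ (βs , e) = β ∷ βs , cong (⟦ β ⟧ᴮ ⊕_) e

record Cut (x : ℕ) : Set where
  constructor cut
  field
    part₁ part₂ : ℕ
    2≤part₁ : 2 ≤ part₁
    2≤part₂ : 2 ≤ part₂
    part₁+part₂ : part₁ + part₂ ≡ x
open Cut

infixr 6 _⊕ᶜ_

_⊕ᶜ_ : ∀ {x} → Cut x → Tally → Tally
κ ⊕ᶜ W = ⟦ part₁ κ ⟧ ⊕ ⟦ part₂ κ ⟧ ⊕ W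

infix 7 _✂_

_✂_ : ∀ c d {2≤c : True (2 ≤? c)} {2≤d : True (2 ≤? d)} → Cut (c + d)
(c ✂ d) {2≤c} {2≤d} = cut c d (toWitness 2≤c) (toWitness 2≤d) refl

SafeCut : ℕ → Set
SafeCut x = Σ[ κ ∈ Cut x ] (∀ {W} → Safe W → Safe (κ ⊕ᶜ W))

data Needy : ℕ → Set where
  five   : Needy 5
  six    : Needy 6
  seven  : Needy 7
  eleven : Needy 11

needy? : ∀ x → Needy x ⊎ Safe ⟦ x ⟧
needy? 0  = inj₂ safe-𝟘
needy? 1  = inj₂ safe-𝟘
needy? 2  = inj₂ safe-𝟘
needy? 3  = inj₂ safe-𝟘
needy? 4  = inj₂ (⟨4⟩ ∷ [] , refl)
needy? 5  = inj₁ five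
needy? 6  = inj₁ six
needy? 7  = inj₁ seven
needy? 8  = inj₂ (⟨8⟩ ∷ [] , refl)
needy? 9  = inj₂ safe-𝟘
needy? 10 = inj₂ safe-𝟘
needy? 11 = inj₁ eleven
needy? (suc (suc (suc (suc (suc (suc (suc (suc (suc (suc (suc (suc _)))))))))))) = inj₂ safe-𝟘

four-absorbs : ∀ x {W} → Safe W → Safe (⟦ 4 ⟧ ⊕ ⟦ x ⟧ ⊕ W)
four-absorbs x s with needy? x
... | inj₁ five   = ⟨4,5⟩ ∷ˢ s
... | inj₁ six    = ⟨4,6⟩ ∷ˢ s
... | inj₁ seven  = ⟨4,7⟩ ∷ˢ s
... | inj₁ eleven = ⟨4,11⟩ ∷ˢ s
... | inj₂ sx     = ⟨4⟩ ∷ˢ safe-⊕ sx s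

needy-cut : ∀ {x} → Needy x → SafeCut x
needy-cut five   = 2 ✂ 3 , λ s → s
needy-cut six    = 3 ✂ 3 , λ s → s
needy-cut seven  = 3 ✂ 4 , ⟨4⟩ ∷ˢ_
needy-cut eleven = 4 ✂ 7 , ⟨4,7⟩ ∷ˢ_

safe-cut : ∀ i → SafeCut (4 + i)
safe-cut 0 = 2 ✂ 2 , λ s → s
safe-cut 1 = 2 ✂ 3 , λ s → s
safe-cut 2 = 3 ✂ 3 , λ s → s
safe-cut 3 = 3 ✂ 4 , ⟨4⟩ ∷ˢ_
safe-cut (suc (suc (suc (suc i)))) = 4 ✂ (4 + i) , four-absorbs (4 + i)

data Response (a b : ℕ) (W : Tally) : Set where
  cut-first  : (κ : Cut a) → Safe (κ ⊕ᶜ ⟦ b ⟧ ⊕ W) → Response a b W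
  cut-second : (κ : Cut b) → Safe (κ ⊕ᶜ ⟦ a ⟧ ⊕ W) → Response a b W
  cut-other  : ∀ {x W'} → Special x → W ≡ ⟦ x ⟧ ⊕ W' → (κ : Cut x) →
               Safe (κ ⊕ᶜ ⟦ a ⟧ ⊕ ⟦ b ⟧ ⊕ W') → Response a b W

swap-response : ∀ {a b W} → Response a b W → Response b a W
swap-response (cut-first κ s)  = cut-second κ s
swap-response (cut-second κ s) = cut-first κ s
swap-response {a} {b} (cut-other {W' = W'} σ e κ s) =
  cut-other σ e κ (subst Safe (cong (κ ⊕ᶜ_) (x⊕y⊕z≡y⊕x⊕z ⟦ a ⟧ ⟦ b ⟧ W')) s)

needy-pair : ∀ {i j W} → Needy (2 + i) → Needy (2 + j) → ⟦ 5 + (i + j) ⟧ ≡ 𝟘 → Safe W →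
             Response (2 + i) (2 + j) W
needy-pair five   five   ()
needy-pair five   six    _ s = cut-second (2 ✂ 4) (⟨4,5⟩ ∷ˢ s)
needy-pair five   seven  _ s = cut-second (3 ✂ 4) (⟨4,5⟩ ∷ˢ s)
needy-pair five   eleven _ s = cut-second (4 ✂ 7) (⟨4,5,7⟩ ∷ˢ s)
needy-pair six    six    _ s = cut-first (2 ✂ 4) (⟨4,6⟩ ∷ˢ s)
needy-pair six    seven  _ s = cut-second (3 ✂ 4) (⟨4,6⟩ ∷ˢ s)
needy-pair six    eleven _ s = cut-first (2 ✂ 4) (⟨4,11⟩ ∷ˢ s)
needy-pair seven  seven  _ s = cut-first (3 ✂ 4) (⟨4,7⟩ ∷ˢ s)
needy-pair seven  eleven _ s = cut-first (3 ✂ 4) (⟨4,11⟩ ∷ˢ s)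
needy-pair eleven eleven _ s = cut-first (3 ✂ 8) (⟨8,11⟩ ∷ˢ s)
needy-pair six    five   z s = swap-response (needy-pair five six z s)
needy-pair seven  five   z s = swap-response (needy-pair five seven z s)
needy-pair eleven five   z s = swap-response (needy-pair five eleven z s)
needy-pair seven  six    z s = swap-response (needy-pair six seven z s)
needy-pair eleven six    z s = swap-response (needy-pair six eleven z s)
needy-pair eleven seven  z s = swap-response (needy-pair seven eleven z s)

calm-pair : ∀ i j {W} → Safe ⟦ 2 + i ⟧ → Safe ⟦ 2 + j ⟧ → ⟦ 5 + (i + j) ⟧ ≡ 𝟘 → Safe W →
            Response (2 + i) (2 + j) W
calm-pair (suc (suc i)) j _ sb _ s = let κ , sκ = safe-cut i in cut-first κ (sκ (safe-⊕ sb s))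
calm-pair i (suc (suc j)) sa _ _ s = let κ , sκ = safe-cut j in cut-second κ (sκ (safe-⊕ sa s))
calm-pair 0 0 _ _ ()
calm-pair 0 1 _ _ ()
calm-pair 1 0 _ _ ()
calm-pair 1 1 _ _ ()

ordinary : ∀ i j {W} → ⟦ 5 + (i + j) ⟧ ≡ 𝟘 → Safe W → Response (2 + i) (2 + j) W
ordinary i j z s with needy? (2 + i) | needy? (2 + j)
... | inj₁ na | inj₁ nb = needy-pair na nb z s
... | inj₁ na | inj₂ sb = let κ , sκ = needy-cut na in cut-first κ (sκ (safe-⊕ sb s))
... | inj₂ sa | inj₁ nb = let κ , sκ = needy-cut nb in cut-second κ (sκ (safe-⊕ sa s))
... | inj₂ sa | inj₂ sb = calm-pair i j sa sb z s

safe-without-7 : ∀ {W} → Safe (⟦ 7 ⟧ ⊕ W) → Safe W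
safe-without-7 s with partner-of-7 s
... | inj₁ (γs , refl) = ⟨4⟩ ∷ˢ (γs , refl)
... | inj₂ (γs , refl) = ⟨4,5⟩ ∷ˢ (γs , refl)

safe-without-11 : ∀ {W} → Safe (⟦ 11 ⟧ ⊕ W) → Safe W
safe-without-11 s with partner-of-11 s
... | inj₁ (γs , refl) = ⟨4⟩ ∷ˢ (γs , refl)
... | inj₂ (γs , refl) = ⟨8⟩ ∷ˢ (γs , refl)

answer₅ : ∀ i j {W} → i + j ≡ 0 → Safe (⟦ 5 ⟧ ⊕ W) → Response (2 + i) (2 + j) W
answer₅ 0 _ refl s with partner-of-5 s
... | inj₁ (γs , refl) = cut-other four refl (2 ✂ 2) (γs , refl)
... | inj₂ (γs , refl) = cut-other seven refl (3 ✂ 4) (⟨4⟩ ∷ ⟨4⟩ ∷ γs , refl)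
answer₅ (suc _) _ ()

answer₆ : ∀ i j {W} → i + j ≡ 1 → Safe (⟦ 6 ⟧ ⊕ W) → Response (2 + i) (2 + j) W
answer₆ 0 _ refl s with partner-of-6 s
... | γs , refl = cut-other four refl (2 ✂ 2) (γs , refl)
answer₆ 1 _ refl s = swap-response (answer₆ 0 1 refl s)
answer₆ (suc (suc _)) _ ()

answer₇ : ∀ i j {W} → i + j ≡ 2 → Safe (⟦ 7 ⟧ ⊕ W) → Response (2 + i) (2 + j) W
answer₇ 0 _ refl s = cut-second (2 ✂ 2) (safe-without-7 s)
answer₇ 1 _ refl s with partner-of-7 s
... | inj₁ (γs , refl) = cut-other four refl (2 ✂ 2) (γs , refl)
... | inj₂ (γs , refl) = cut-other five refl (2 ✂ 3) (⟨4⟩ ∷ γs , refl)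
answer₇ 2 _ refl s = swap-response (answer₇ 0 2 refl s)
answer₇ (suc (suc (suc _))) _ ()

answer₈ : ∀ i j {W} → i + j ≡ 3 → Safe (⟦ 8 ⟧ ⊕ W) → Response (2 + i) (2 + j) W
answer₈ 0 _ refl s with partner-of-8 s
... | inj₁ s′           = cut-second (2 ✂ 3) s′
... | inj₂ (γs , refl) = cut-other eleven refl (4 ✂ 7) (⟨4,5,7⟩ ∷ γs , refl)
answer₈ 1 _ refl s with partner-of-8 s
... | inj₁ s′           = cut-second (2 ✂ 2) s′
... | inj₂ (γs , refl) = cut-other eleven refl (4 ✂ 7) (⟨4,7⟩ ∷ ⟨4⟩ ∷ γs , refl)
answer₈ 2 _ refl s = swap-response (answer₈ 1 2 refl s)
answer₈ 3 _ refl s = swap-response (answer₈ 0 3 refl s)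
answer₈ (suc (suc (suc (suc _)))) _ ()

answer₁₁ : ∀ i j {W} → i + j ≡ 6 → Safe (⟦ 11 ⟧ ⊕ W) → Response (2 + i) (2 + j) W
answer₁₁ 0 _ refl s = cut-second (4 ✂ 4) (⟨4⟩ ∷ˢ ⟨4⟩ ∷ˢ safe-without-11 s)
answer₁₁ 1 _ refl s = cut-second (3 ✂ 4) (⟨4⟩ ∷ˢ safe-without-11 s)
answer₁₁ 2 _ refl s = cut-second (2 ✂ 4) (⟨4⟩ ∷ˢ ⟨4⟩ ∷ˢ safe-without-11 s)
answer₁₁ 3 _ refl s with partner-of-11 s
... | inj₁ (γs , refl) = cut-first (2 ✂ 3) (⟨4,5⟩ ∷ γs , refl)
... | inj₂ (γs , refl) = cut-other eight refl (4 ✂ 4) (⟨4,5⟩ ∷ ⟨4,5⟩ ∷ γs , refl)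
answer₁₁ 4 _ refl s = swap-response (answer₁₁ 2 4 refl s)
answer₁₁ 5 _ refl s = swap-response (answer₁₁ 1 5 refl s)
answer₁₁ 6 _ refl s = swap-response (answer₁₁ 0 6 refl s)
answer₁₁ (suc (suc (suc (suc (suc (suc (suc _))))))) _ ()

answer : ∀ i j {W} → Safe (⟦ 5 + (i + j) ⟧ ⊕ W) → Response (2 + i) (2 + j) W
answer i j s with i + j in eq
... | 0 = answer₅ i j eq s
... | 1 = answer₆ i j eq s
... | 2 = answer₇ i j eq s
... | 3 = answer₈ i j eq s
... | 4 = ordinary i j (cong (λ m → ⟦ 5 + m ⟧) eq) s
... | 5 = ordinary i j (cong (λ m → ⟦ 5 + m ⟧) eq) s
... | 6 = answer₁₁ i j eq s
... | suc (suc (suc (suc (suc (suc (suc _)))))) = ordinary i j (cong (λ m → ⟦ 5 + m ⟧) eq) s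

right-reply : ∀ {a b W} → 2 ≤ a → 2 ≤ b → Safe (⟦ suc (a + b) ⟧ ⊕ W) → Response a b W
right-reply {suc (suc i)} {suc (suc j)} {W} (s≤s (s≤s z≤n)) (s≤s (s≤s z≤n)) s =
  answer i j (subst (λ k → Safe (⟦ k ⟧ ⊕ W)) (cong (3 +_) (trans (+-suc i (suc j)) (cong suc (+-suc i j)))) s)

-- 8 ≤ 5, 8 ≤ 6 and 8 ≤ 7 are refuted by evaluating _≤ᵇ_.
safe-single : ∀ {x} → 8 ≤ x → x ≢ 11 → Safe ⟦ x ⟧
safe-single {x} 8≤x x≢11 with needy? x
... | inj₁ five   = ⊥-elim (≤⇒≤ᵇ 8≤x)
... | inj₁ six    = ⊥-elim (≤⇒≤ᵇ 8≤x)
... | inj₁ seven  = ⊥-elim (≤⇒≤ᵇ 8≤x)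
... | inj₁ eleven = ⊥-elim (x≢11 refl)
... | inj₂ s      = s

-- Right's strategy

tally : List Segment → Tally
tally = Σᵀ (⟦_⟧ ∘ size)

total : List Segment → ℕ
total segs = sum (map size segs)

total-↭ : ∀ {segs segs′} → segs ↭ segs′ → total segs ≡ total segs′
total-↭ σ = sum-↭ (map⁺ size σ)

record SafeReply {n} (G : Graph n) (t : ℕ) : Set where
  field
    after    : Graph n
    move     : RightMove G after
    segments : List Segment
    layout   : Layout after segments
    safe     : Safe (tally segments)
    total≡   : total segments ≡ t

cut-front : ∀ {n} {G : Graph n} {l h rest} → Layout G ([ l , h ⟩ ∷ rest) →
            (κ : Cut (h ∸ l)) → Safe (κ ⊕ᶜ tally rest) → SafeReply G (total ([ l , h ⟩ ∷ rest))
cut-front {n} {G} {l} {h} {rest} L (cut c d 2≤c 2≤d c+d≡h∸l) s = reply (right-cut L 2+l≤l+c 2+l+c≤h)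
  where
  l+c+d≡h : l + c + d ≡ h
  l+c+d≡h = trans (+-assoc l c d) (trans (cong (l +_) c+d≡h∸l) (m+[n∸m]≡n (≤-trans (m≤n+m l 2) (lo+2≤hi L))))
  2+l≤l+c : 2 + l ≤ l + c
  2+l≤l+c = subst (_≤ l + c) (+-comm l 2) (+-monoʳ-≤ l 2≤c)
  2+l+c≤h : 2 + (l + c) ≤ h
  2+l+c≤h = subst₂ _≤_ (+-comm (l + c) 2) l+c+d≡h (+-monoʳ-≤ (l + c) 2≤d)
  first≡c : (l + c) ∸ l ≡ c
  first≡c = m+n∸m≡n l c
  second≡d : h ∸ (l + c) ≡ d
  second≡d = trans (cong (_∸ (l + c)) (sym l+c+d≡h)) (m+n∸m≡n (l + c) d)
  reply : Σ[ G′ ∈ Graph n ] RightMove G G′ × Layout G′ ([ l , l + c ⟩ ∷ [ l + c , h ⟩ ∷ rest) →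
          SafeReply G (total ([ l , h ⟩ ∷ rest))
  reply (G′ , move , L′) = record
    { after = G′ ; move = move ; segments = _ ; layout = L′
    ; safe = subst Safe (cong₂ (λ x y → ⟦ x ⟧ ⊕ ⟦ y ⟧ ⊕ tally rest) (sym first≡c) (sym second≡d)) s
    ; total≡ = begin
        (l + c) ∸ l + (h ∸ (l + c) + total rest) ≡⟨ cong₂ (λ x y → x + (y + total rest)) first≡c second≡d ⟩
        c + (d + total rest)                     ≡⟨ +-assoc c d _ ⟨
        c + d + total rest                       ≡⟨ cong (_+ total rest) c+d≡h∸l ⟩
        h ∸ l + total rest                       ∎ }
    where open ≡-Reasoning

cut-focused : ∀ {n} {G : Graph n} {segs T rest} → Layout G segs → segs ↭ T ∷ rest →
              (κ : Cut (size T)) → Safe (κ ⊕ᶜ tally rest) → SafeReply G (total segs)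
cut-focused L σ κ s = subst (SafeReply _) (sym (total-↭ σ)) (cut-front (layout-↭ σ L) κ s)

segment-of-size : ∀ {x W} (σ : Special x) R → tally R ≡ ⟦ x ⟧ ⊕ W →
                  Σ[ T ∈ Segment ] Σ[ R′ ∈ List Segment ] R ↭ T ∷ R′ × size T ≡ x × tally R′ ≡ W
segment-of-size {x} {W} σ R tally≡ with Any-↭ (Σᵀ-witness (⟦_⟧ ∘ size) σ R (subst (λ V → 1 ≤ multiplicity σ V) (sym tally≡) (multiplicity-self σ)))
... | T , R′ , R↭ , 1≤ = T , R′ , R↭ , size≡ , ⊕-cancelˡ ⟦ x ⟧ (begin
  ⟦ x ⟧ ⊕ tally R′      ≡⟨ cong (λ y → ⟦ y ⟧ ⊕ tally R′) size≡ ⟨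
  ⟦ size T ⟧ ⊕ tally R′ ≡⟨ Σᵀ-↭ (⟦_⟧ ∘ size) R↭ ⟨
  tally R               ≡⟨ tally≡ ⟩
  ⟦ x ⟧ ⊕ W             ∎)
  where
  open ≡-Reasoning
  size≡ = multiplicity-⟦⟧ σ (size T) 1≤

play-response : ∀ {n} {G : Graph n} {S₁ S₂ R} → Layout G (S₁ ∷ S₂ ∷ R) →
                Response (size S₁) (size S₂) (tally R) → SafeReply G (total (S₁ ∷ S₂ ∷ R))
play-response L (cut-first κ s)  = cut-focused L ↭-refl κ s
play-response L (cut-second κ s) = cut-focused L (↭-swap _ _ ↭-refl) κ s
play-response {S₁ = S₁} {S₂} {R} L (cut-other σ tally≡ κ s) with segment-of-size σ R tally≡
... | T , R′ , R↭ , refl , refl =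
  cut-focused L (↭-trans (↭-prep S₁ (↭-prep S₂ R↭)) (shift T (S₁ ∷ S₂ ∷ []) R′)) κ s

∸-split : ∀ {l v h} → l ≤ v → v < h → h ∸ l ≡ suc ((v ∸ l) + (h ∸ suc v))
∸-split {l} {v} {h} l≤v v<h = begin
  h ∸ l                          ≡⟨ cong (_∸ l) (m∸n+n≡m (<⇒≤ v<h)) ⟨
  (h ∸ v + v) ∸ l                ≡⟨ +-∸-assoc (h ∸ v) l≤v ⟩
  h ∸ v + (v ∸ l)                ≡⟨ +-comm (h ∸ v) _ ⟩
  (v ∸ l) + (h ∸ v)              ≡⟨ cong ((v ∸ l) +_) (+-∸-assoc 1 v<h) ⟩
  (v ∸ l) + suc (h ∸ suc v)      ≡⟨ +-suc (v ∸ l) _ ⟩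
  suc ((v ∸ l) + (h ∸ suc v))    ∎
  where open ≡-Reasoning

reply-to-left : ∀ {n} {G G′ : Graph n} {segs} → Layout G segs → Safe (tally segs) → LeftMove G G′ →
                Σ[ t ∈ ℕ ] t < total segs × SafeReply G′ t
reply-to-left {segs = segs} L s (delV v present-v deg≢1 ¬iso) with Any-↭ (to (present⇔ L v) (from T-≡ present-v))
... | S , R , σ , v∈S = _ , shrinks , play-response L₁ (right-reply 2≤a 2≤b s₁)
  where
  L₀ = layout-↭ σ L
  interior = left-move-is-interior L₀ v∈S deg≢1 ¬iso
  L₁ = layout-deleteVertex L₀ (proj₁ interior) (proj₂ interior)
  a = toℕ v ∸ lo S
  b = hi S ∸ suc (toℕ v)
  2≤a : 2 ≤ a
  2≤a = m+n≤o⇒m≤o∸n 2 (proj₁ interior)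
  2≤b : 2 ≤ b
  2≤b = m+n≤o⇒m≤o∸n 2 (proj₂ interior)
  size≡ : size S ≡ suc (a + b)
  size≡ = ∸-split (proj₁ v∈S) (proj₂ v∈S)
  s₁ : Safe (⟦ suc (a + b) ⟧ ⊕ tally R)
  s₁ = subst (λ k → Safe (⟦ k ⟧ ⊕ tally R)) size≡ (subst Safe (Σᵀ-↭ (⟦_⟧ ∘ size) σ) s)
  shrinks : a + (b + total R) < total segs
  shrinks = begin-strict
    a + (b + total R)     <⟨ s≤s (≤-reflexive (sym (+-assoc a b _))) ⟩
    suc (a + b) + total R ≡⟨ cong (_+ total R) size≡ ⟨
    total (S ∷ R)         ≡⟨ total-↭ σ ⟨
    total segs            ∎
    where open ≤-Reasoning

right-wins : ∀ {n} {G : Graph n} {segs} → Acc _<_ (total segs) → Layout G segs → Safe (tally segs) →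
             RightWinsLeftToMove G
right-wins {segs = segs} (acc smaller) L s = allLeft λ G′ left-move →
  let t , t<total , r = reply-to-left L s left-move
      open SafeReply r
  in someRight after move (right-wins (smaller (subst (_< total segs) (sym total≡) t<total)) layout safe)

theorem3p11 : (n : ℕ) → 8 ≤ n → n ≢ 11 →
    RightWinsLeftToMove (path n) × RightWinsRightToMove (path n)
theorem3p11 n 8≤n n≢11 = right-wins (<-wellFounded _) P (safe-⊕ (safe-single 8≤n n≢11) safe-𝟘) , first-cut
  where
  P = path-layout n (≤-trans (m≤n+m 2 6) 8≤n)
  first-cut : RightWinsRightToMove (path n)
  first-cut with right-cut P (m≤n+m 2 2) (≤-trans (m≤n+m 6 2) 8≤n)
  ... | G′ , move , L′ = someRight G′ move (right-wins (<-wellFounded _) L′ (four-absorbs (n ∸ 4) safe-𝟘))
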